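{- For every integer $n\geq 3$, $ar(K^{(3)}_{n,n,n},\mathcal{M})=n+1$ and $ar(K^{(3)}_{n,n,n},\mathcal{T})=ar(K^{(3)}_{n,n,n},\mathcal{L})=n+2$.
   Context: $K^{(3)}_{n,n,n}$ is the complete 3-partite 3-graph with three parts of size $n$. For a 3-partite 3-graph $G$, $ar(K^{(3)}_{n,n,n},G)$ is the minimum $k$ such that every edge-coloring of $K^{(3)}_{n,n,n}$ with at least $k$ colors contains a rainbow copy of $G$ (edges of pairwise distinct colors). $\mathcal{T}$ has edges $\{v_1v_2v_3,v_2v_3v_4,v_3v_4v_5\}$, $\mathcal{M}$ has edges $\{v_1v_2v_3,v_2v_3v_4,v_4v_5v_6\}$, $\mathcal{L}$ has edges $\{v_1v_2v_3,v_3v_4v_5,v_5v_6v_7\}$. -}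

module Defs where

open import Data.Nat using (ℕ; _≤_)
open import Data.Fin using (Fin; zero; suc)
open import Data.Product using (_×_; _,_; Σ; Σ-syntax; proj₁; proj₂)
open import Data.Sum using (_⊎_)
open import Relation.Binary.PropositionalEquality using (_≡_)
open import Function.Definitions using (Injective)

-- A 3-uniform hypergraph given by v vertices (Fin v) and m edges, each edge a
-- triple of vertices (for all graphs used here, the three vertices are distinct).
record Hyp3 : Set where
  field
    nv    : ℕ
    ne    : ℕ
    edge  : Fin ne → Fin nv × Fin nv × Fin nv

-- Host: K^{(3)}_{n,n,n}.  Vertices are (part, index) ∈ Fin 3 × Fin n.
KVertex : ℕ → Set
KVertex n = Fin 3 × Fin n

-- Edges of K^{(3)}_{n,n,n}: one vertex from each part, encoded by the triple of indices.
KEdge : ℕ → Set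
KEdge n = Fin n × Fin n × Fin n

_∈KE_ : ∀ {n} → KVertex n → KEdge n → Set
x ∈KE (a , b , c) = (x ≡ (zero , a)) ⊎ (x ≡ (suc zero , b)) ⊎ (x ≡ (suc (suc zero) , c))

Colouring : ℕ → Set
Colouring n = KEdge n → ℕ

UsesAtLeast : ∀ {n} → Colouring n → ℕ → Set
UsesAtLeast {n} col k =
  Σ[ f ∈ (Fin k → KEdge n) ] Injective _≡_ _≡_ (λ i → col (f i))

RainbowCopy : ∀ {n} → Colouring n → Hyp3 → Set
RainbowCopy {n} col G =
  Σ[ φ ∈ (Fin nv → KVertex n) ] Σ[ ψ ∈ (Fin ne → KEdge n) ]
    Injective _≡_ _≡_ φ
    × (∀ j → let (x , y , z) = edge j in
               (φ x ∈KE ψ j) × (φ y ∈KE ψ j) × (φ z ∈KE ψ j))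
    × Injective _≡_ _≡_ (λ j → col (ψ j))
  where open Hyp3 G

Forces : ℕ → Hyp3 → ℕ → Set
Forces n G k = (col : Colouring n) → UsesAtLeast col k → RainbowCopy col G

AR≡ : ℕ → Hyp3 → ℕ → Set
AR≡ n G r = Forces n G r × (∀ k → Forces n G k → r ≤ k)

v₁ v₂ v₃ v₄ v₅ : ∀ {m} → Fin (5 Data.Nat.+ m)
v₁ = zero
v₂ = suc zero
v₃ = suc (suc zero)
v₄ = suc (suc (suc zero))
v₅ = suc (suc (suc (suc zero)))

v₆ : ∀ {m} → Fin (6 Data.Nat.+ m)
v₆ = suc (suc (suc (suc (suc zero))))

v₇ : ∀ {m} → Fin (7 Data.Nat.+ m)
v₇ = suc (suc (suc (suc (suc (suc zero)))))

𝒯 : Hyp3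
𝒯 = record { nv = 5 ; ne = 3 ; edge = e }
  where
  e : Fin 3 → Fin 5 × Fin 5 × Fin 5
  e zero = v₁ , v₂ , v₃
  e (suc zero) = v₂ , v₃ , v₄
  e (suc (suc zero)) = v₃ , v₄ , v₅

ℳ : Hyp3
ℳ = record { nv = 6 ; ne = 3 ; edge = e }
  where
  e : Fin 3 → Fin 6 × Fin 6 × Fin 6
  e zero = v₁ , v₂ , v₃
  e (suc zero) = v₂ , v₃ , v₄
  e (suc (suc zero)) = v₄ , v₅ , v₆

ℒ : Hyp3
ℒ = record { nv = 7 ; ne = 3 ; edge = e }
  where
  e : Fin 3 → Fin 7 × Fin 7 × Fin 7
  e zero = v₁ , v₂ , v₃
  e (suc zero) = v₃ , v₄ , v₅
  e (suc (suc zero)) = v₅ , v₆ , v₇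

-- Colouring every edge by its first coordinate uses n colours, and in a copy of ℳ
-- the middle edge shares its vertex in part 0 with one of the other two edges.  Colouring the
-- diagonal edges (a , a , a), respectively the edges (a , z , z) of one line, by a and all other
-- edges by one further colour uses n + 1 colours, and a rainbow copy would contain two of the
-- special edges: impossible for 𝒯, whose three edges share a vertex, as diagonal edges are
-- disjoint, and impossible for ℒ, whose edges pairwise share at most one vertex, as edges of a
-- line share two.
--
-- Up to permuting the parts, two colours force a line (· , y , z) with two
-- colours.  For ℳ and 𝒯, a line with three colours forces, unless a rainbow copy appears, every
-- edge (s , t , w) to have the colour of (s , y , z), so only n colours occur.  For ℳ, if the line
-- only has colours A and B, then so has every edge.  For 𝒯, a plane (a , · , ·) with three colours
-- contains 𝒯; otherwise two planes with two colours each and an edge of a fifth colour span a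
-- line with three colours.  For ℒ, three pairwise disjoint edges with distinct colours contain ℒ.
-- Otherwise there are pairwise disjoint p, q, q′ with col q = col q′ ≠ col p; then every edge of
-- a colour other than col p and col q lies on a line through p, all of them on the same line,
-- so at most n + 1 colours occur.
module Submission where

open import Data.Bool using (if_then_else_)
open import Data.Empty using (⊥; ⊥-elim)
open import Data.Fin as Fin using (Fin; suc; toℕ; punchIn; _≟_)
open import Data.Fin.Patterns
import Data.Fin.Properties as Finₚ
open import Data.Fin.Permutation
  using (Permutation′; _⟨$⟩ʳ_; _⟨$⟩ˡ_; inverseʳ; inverseˡ; transpose; flip; _∘ₚ_)
import Data.Fin.Permutation as Perm
open import Data.Nat as ℕ using (ℕ; _≤_; _<_; _+_; s≤s; z≤n)
import Data.Nat.Properties as ℕₚ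
open import Data.Product using (_×_; _,_; ∃; ∃₂; Σ-syntax; proj₁; proj₂)
import Data.Product.Properties as Productₚ
open import Data.Sum using (_⊎_; inj₁; inj₂; map₁; map₂; fromInj₁)
open import Data.Sum.Effectful.Left using (monad)
open import Effect.Monad using (RawMonad)
open import Function using (_∘_; case_of_)
open import Function.Consequences.Propositional
  using (inverseʳ⇒injective; strictlyInverseʳ⇒inverseʳ)
open import Function.Definitions using (Injective)
open import Level using (0ℓ)
open import Relation.Binary.Definitions using (DecidableEquality)
open import Relation.Binary.PropositionalEquality
open import Relation.Nullary using (¬_; Dec; yes; no; does; ¬?)
open import Relation.Nullary.Decidable
  using (dec-true; dec-false; toWitness; decidable-stable; _×-dec_; _⊎-dec_; _→-dec_)
open import Relation.Unary using (Decidable)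

open import Defs

-- "A rainbow copy, or else P" is stated as RainbowCopy col G ⊎ P; do-notation chains such steps.
module _ {A : Set} where
  open RawMonad (monad A 0ℓ) public using (_>>=_; pure)

Distinct₃ : ∀ {A : Set} → A → A → A → Set
Distinct₃ a b c = a ≢ b × a ≢ c × b ≢ c

Distinct₄ : ∀ {A : Set} → A → A → A → A → Set
Distinct₄ a b c d = Distinct₃ a b c × a ≢ d × b ≢ d × c ≢ d

Distinct₃-map : ∀ {A B : Set} {f : A → B} → Injective _≡_ _≡_ f → ∀ {a b c} →
                Distinct₃ a b c → Distinct₃ (f a) (f b) (f c)
Distinct₃-map injective (a≢b , a≢c , b≢c) = a≢b ∘ injective , a≢c ∘ injective , b≢c ∘ injective

Distinct₄-map : ∀ {A B : Set} {f : A → B} → Injective _≡_ _≡_ f → ∀ {a b c d} →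
                Distinct₄ a b c d → Distinct₄ (f a) (f b) (f c) (f d)
Distinct₄-map injective (distinct , a≢d , b≢d , c≢d) =
  Distinct₃-map injective distinct , a≢d ∘ injective , b≢d ∘ injective , c≢d ∘ injective

Distinct₃-respects : ∀ {A : Set} {a a′ b b′ c c′ : A} → a ≡ a′ → b ≡ b′ → c ≡ c′ →
                     Distinct₃ a′ b′ c′ → Distinct₃ a b c
Distinct₃-respects refl refl refl distinct = distinct

distinct₃⇒injective : ∀ {A : Set} {f : Fin 3 → A} → Distinct₃ (f 0F) (f 1F) (f 2F) → Injective _≡_ _≡_ f
distinct₃⇒injective _             {0F} {0F} _  = refl
distinct₃⇒injective (≢₀₁ , _ , _) {0F} {1F} eq = ⊥-elim (≢₀₁ eq)
distinct₃⇒injective (_ , ≢₀₂ , _) {0F} {2F} eq = ⊥-elim (≢₀₂ eq)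
distinct₃⇒injective (≢₀₁ , _ , _) {1F} {0F} eq = ⊥-elim (≢₀₁ (sym eq))
distinct₃⇒injective _             {1F} {1F} _  = refl
distinct₃⇒injective (_ , _ , ≢₁₂) {1F} {2F} eq = ⊥-elim (≢₁₂ eq)
distinct₃⇒injective (_ , ≢₀₂ , _) {2F} {0F} eq = ⊥-elim (≢₀₂ (sym eq))
distinct₃⇒injective (_ , _ , ≢₁₂) {2F} {1F} eq = ⊥-elim (≢₁₂ (sym eq))
distinct₃⇒injective _             {2F} {2F} _  = refl

injective⇒distinct₃ : ∀ {A : Set} {f : Fin 3 → A} → Injective _≡_ _≡_ f → Distinct₃ (f 0F) (f 1F) (f 2F)
injective⇒distinct₃ injective =
  (λ eq → case injective eq of λ ()) , (λ eq → case injective eq of λ ()) , (λ eq → case injective eq of λ ())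

avoiding : ∀ {X A : Set} → DecidableEquality A → (c : X → A) {x₁ x₂ x₃ : X} →
           Distinct₃ (c x₁) (c x₂) (c x₃) → (d d′ : A) → Σ[ x ∈ X ] c x ≢ d × c x ≢ d′
avoiding _≟ᴬ_ c {x₁} {x₂} {x₃} (≢₁₂ , ≢₁₃ , ≢₂₃) d d′
  with c x₁ ≟ᴬ d | c x₁ ≟ᴬ d′ | c x₂ ≟ᴬ d | c x₂ ≟ᴬ d′
... | no ≢d | no ≢d′ | _     | _      = x₁ , ≢d , ≢d′
... | _     | _      | no ≢d | no ≢d′ = x₂ , ≢d , ≢d′
... | yes p | _      | yes q | _      = ⊥-elim (≢₁₂ (trans p (sym q)))
... | _     | yes p  | _     | yes q  = ⊥-elim (≢₁₂ (trans p (sym q)))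
... | yes p | _      | _     | yes q  = x₃ , (λ r → ≢₁₃ (trans p (sym r))) , (λ r → ≢₂₃ (trans q (sym r)))
... | _     | yes p  | yes q | _      = x₃ , (λ r → ≢₂₃ (trans q (sym r))) , (λ r → ≢₁₃ (trans p (sym r)))

two-avoiding : ∀ {X : Set} (c : X → ℕ) {x₁ x₂ x₃} → Distinct₃ (c x₁) (c x₂) (c x₃) → ∀ d →
               Σ[ p ∈ X ] Σ[ q ∈ X ] c p ≢ d × c q ≢ d × c p ≢ c q
two-avoiding c distinct d with avoiding ℕ._≟_ c distinct d d
... | p , p≢d , _ with avoiding ℕ._≟_ c distinct d (c p)
... | q , q≢d , q≢p = p , q , p≢d , q≢d , q≢p ∘ sym

fresh-index : ∀ {n} → 3 ≤ n → (a b : Fin n) → Σ[ c ∈ Fin n ] c ≢ a × c ≢ b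
fresh-index (s≤s (s≤s (s≤s _))) = avoiding _≟_ (λ i → i) {0F} {1F} {2F} ((λ ()) , (λ ()) , (λ ()))

Fin3-cover : ∀ (a b c k : Fin 3) → Distinct₃ a b c → k ≡ a ⊎ k ≡ b ⊎ k ≡ c
Fin3-cover = toWitness {a? = Finₚ.all? λ a → Finₚ.all? λ b → Finₚ.all? λ c → Finₚ.all? λ k →
  (¬? (a ≟ b) ×-dec ¬? (a ≟ c) ×-dec ¬? (b ≟ c)) →-dec (k ≟ a ⊎-dec k ≟ b ⊎-dec k ≟ c)} _

OneOf : ℕ → ℕ → ℕ → Set
OneOf a b c = c ≡ a ⊎ c ≡ b

one-of? : ∀ a b c → Dec (OneOf a b c)
one-of? a b c = c ℕ.≟ a ⊎-dec c ℕ.≟ b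

¬OneOf⇒≢ : ∀ {a b c d} → ¬ OneOf a b c → OneOf a b d → c ≢ d
¬OneOf⇒≢ outside (inj₁ refl) c≡d = outside (inj₁ c≡d)
¬OneOf⇒≢ outside (inj₂ refl) c≡d = outside (inj₂ c≡d)

the-other : ∀ {X : Set} (c : X → ℕ) {x₁ x₂} → c x₁ ≢ c x₂ → ∀ {d} → OneOf (c x₁) (c x₂) d →
            Σ[ x ∈ X ] OneOf (c x₁) (c x₂) (c x) × c x ≢ d
the-other c {x₁} {x₂} x₁≢x₂ (inj₁ refl) = x₂ , inj₂ refl , x₁≢x₂ ∘ sym
the-other c {x₁} {x₂} x₁≢x₂ (inj₂ refl) = x₁ , inj₁ refl , x₁≢x₂

pair-excludes-third : ∀ {a b c d : ℕ} → Distinct₃ a b c → OneOf a d b → ¬ OneOf a d c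
pair-excludes-third (a≢b , _ , _) (inj₁ b≡a) _          = a≢b (sym b≡a)
pair-excludes-third (_ , a≢c , _) _          (inj₁ c≡a) = a≢c (sym c≡a)
pair-excludes-third (_ , _ , b≢c) (inj₂ b≡d) (inj₂ c≡d) = b≢c (trans b≡d (sym c≡d))

module _ {n : ℕ} where

  coord : KEdge n → Fin 3 → Fin n
  coord (a , b , c) 0F = a
  coord (a , b , c) 1F = b
  coord (a , b , c) 2F = c

  coord-ext : ∀ {e e′ : KEdge n} → (∀ k → coord e k ≡ coord e′ k) → e ≡ e′
  coord-ext {_ , _ , _} {_ , _ , _} eq = cong₂ _,_ (eq 0F) (cong₂ _,_ (eq 1F) (eq 2F))

  ∈KE⇒coord : ∀ {x : KVertex n} {e} → x ∈KE e → proj₂ x ≡ coord e (proj₁ x)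
  ∈KE⇒coord {e = _ , _ , _} (inj₁ refl)        = refl
  ∈KE⇒coord {e = _ , _ , _} (inj₂ (inj₁ refl)) = refl
  ∈KE⇒coord {e = _ , _ , _} (inj₂ (inj₂ refl)) = refl

  coord∈KE : ∀ (e : KEdge n) k → (k , coord e k) ∈KE e
  coord∈KE (_ , _ , _) 0F = inj₁ refl
  coord∈KE (_ , _ , _) 1F = inj₂ (inj₁ refl)
  coord∈KE (_ , _ , _) 2F = inj₂ (inj₂ refl)

  ∈KE-unique : ∀ {x y : KVertex n} {e} → x ∈KE e → y ∈KE e → proj₁ x ≡ proj₁ y → x ≡ y
  ∈KE-unique {k , _} {.k , _} x∈e y∈e refl = cong (k ,_) (trans (∈KE⇒coord x∈e) (sym (∈KE⇒coord y∈e)))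

  ∈KE-cover : ∀ {w x y z : KVertex n} {e} → w ∈KE e → x ∈KE e → y ∈KE e → z ∈KE e →
              Distinct₃ x y z → w ≡ x ⊎ w ≡ y ⊎ w ≡ z
  ∈KE-cover {w} {x} {y} {z} w∈e x∈e y∈e z∈e (x≢y , x≢z , y≢z) =
    same-part (Fin3-cover (proj₁ x) (proj₁ y) (proj₁ z) (proj₁ w)
      (x≢y ∘ ∈KE-unique x∈e y∈e , x≢z ∘ ∈KE-unique x∈e z∈e , y≢z ∘ ∈KE-unique y∈e z∈e))
    where
    same-part : proj₁ w ≡ proj₁ x ⊎ proj₁ w ≡ proj₁ y ⊎ proj₁ w ≡ proj₁ z → w ≡ x ⊎ w ≡ y ⊎ w ≡ z
    same-part (inj₁ w~x)        = inj₁ (∈KE-unique w∈e x∈e w~x)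
    same-part (inj₂ (inj₁ w~y)) = inj₂ (inj₁ (∈KE-unique w∈e y∈e w~y))
    same-part (inj₂ (inj₂ w~z)) = inj₂ (inj₂ (∈KE-unique w∈e z∈e w~z))

_∈ᵉ_ : ∀ {m} → Fin m → Fin m × Fin m × Fin m → Set
u ∈ᵉ (a , b , c) = u ≡ a ⊎ u ≡ b ⊎ u ≡ c

∈KE-image : ∀ {n m} {φ : Fin m → KVertex n} → Injective _≡_ _≡_ φ → ∀ {a b c} → Distinct₃ a b c →
            ∀ {e} → φ a ∈KE e → φ b ∈KE e → φ c ∈KE e → ∀ {w} → w ∈KE e →
            Σ[ u ∈ Fin m ] u ∈ᵉ (a , b , c) × w ≡ φ u
∈KE-image {m = m} {φ} φ-injective {a} {b} {c} distinct a∈e b∈e c∈e w∈e =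
  preimage (∈KE-cover w∈e a∈e b∈e c∈e (Distinct₃-map φ-injective distinct))
  where
  preimage : ∀ {w} → w ≡ φ a ⊎ w ≡ φ b ⊎ w ≡ φ c → Σ[ u ∈ Fin m ] u ∈ᵉ (a , b , c) × w ≡ φ u
  preimage (inj₁ w≡φa)        = a , inj₁ refl , w≡φa
  preimage (inj₂ (inj₁ w≡φb)) = b , inj₂ (inj₁ refl) , w≡φb
  preimage (inj₂ (inj₂ w≡φc)) = c , inj₂ (inj₂ refl) , w≡φc

-- Permuting the three parts

module _ {n : ℕ} where

  permute : Permutation′ 3 → KEdge n → KEdge n
  permute π e = coord e (π ⟨$⟩ʳ 0F) , coord e (π ⟨$⟩ʳ 1F) , coord e (π ⟨$⟩ʳ 2F)

  coord-permute : ∀ π e k → coord (permute π e) k ≡ coord e (π ⟨$⟩ʳ k)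
  coord-permute π e 0F = refl
  coord-permute π e 1F = refl
  coord-permute π e 2F = refl

  permute-flip : ∀ π e → permute π (permute (flip π) e) ≡ e
  permute-flip π e = coord-ext λ k → begin
    coord (permute π (permute (flip π) e)) k  ≡⟨ coord-permute π _ k ⟩
    coord (permute (flip π) e) (π ⟨$⟩ʳ k)     ≡⟨ coord-permute (flip π) e _ ⟩
    coord e (π ⟨$⟩ˡ (π ⟨$⟩ʳ k))               ≡⟨ cong (coord e) (inverseˡ π) ⟩
    coord e k                                 ∎
    where open ≡-Reasoning

  permute-vertex : Permutation′ 3 → KVertex n → KVertex n
  permute-vertex π (k , i) = π ⟨$⟩ˡ k , i

  permute-vertex-injective : ∀ π → Injective _≡_ _≡_ (permute-vertex π)
  permute-vertex-injective π {k , _} {k′ , _} eq = cong₂ _,_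
    (trans (sym (inverseʳ π)) (trans (cong ((π ⟨$⟩ʳ_) ∘ proj₁) eq) (inverseʳ π)))
    (cong proj₂ eq)

  permute-∈KE : ∀ π {x : KVertex n} {e} → x ∈KE e → permute-vertex π x ∈KE permute π e
  permute-∈KE π {k , i} {e} x∈e = subst (λ j → (π ⟨$⟩ˡ k , j) ∈KE permute π e) coord≡i (coord∈KE _ _)
    where
    coord≡i : coord (permute π e) (π ⟨$⟩ˡ k) ≡ i
    coord≡i = trans (coord-permute π e _) (trans (cong (coord e) (inverseʳ π)) (sym (∈KE⇒coord x∈e)))

  module _ (col : Colouring n) where

    rainbow-unpermute : ∀ π {G} → RainbowCopy (col ∘ permute π) G → RainbowCopy col G
    rainbow-unpermute π (φ , ψ , φ-injective , hits , rainbow) =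
      permute-vertex π ∘ φ , permute π ∘ ψ , φ-injective ∘ permute-vertex-injective π ,
      (λ j → let x∈ψⱼ , y∈ψⱼ , z∈ψⱼ = hits j in permute-∈KE π x∈ψⱼ , permute-∈KE π y∈ψⱼ , permute-∈KE π z∈ψⱼ) ,
      rainbow

    uses-permute : ∀ π {k} → UsesAtLeast col k → UsesAtLeast (col ∘ permute π) k
    uses-permute π (f , injective) =
      permute (flip π) ∘ f ,
      λ eq → injective (subst₂ (λ e e′ → col e ≡ col e′) (permute-flip π (f _)) (permute-flip π (f _)) eq)

swap₀₁ swap₀₂ swap₁₂ rotʳ rotˡ : Permutation′ 3
swap₀₁ = transpose 0F 1F
swap₀₂ = transpose 0F 2F
swap₁₂ = transpose 1F 2F
-- permute rotʳ (x , y , z) = (z , x , y) and permute rotˡ (x , y , z) = (y , z , x).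
rotʳ = swap₀₁ ∘ₚ swap₁₂
rotˡ = swap₁₂ ∘ₚ swap₀₁

-- Rainbow copies from coordinates

EdgesHit : ∀ {n} (G : Hyp3) → (Fin (Hyp3.nv G) → KVertex n) → (Fin (Hyp3.ne G) → KEdge n) → Set
EdgesHit G φ ψ = ∀ j → let (x , y , z) = edge j in (φ x ∈KE ψ j) × (φ y ∈KE ψ j) × (φ z ∈KE ψ j)
  where open Hyp3 G

module _ {n : ℕ} (col : Colouring n) where

  rainbow-copy : ∀ {G} (φ : Fin (Hyp3.nv G) → KVertex n) (φ⁻¹ : KVertex n → Fin (Hyp3.nv G)) →
                 (∀ v → φ⁻¹ (φ v) ≡ v) → (ψ : Fin (Hyp3.ne G) → KEdge n) → EdgesHit G φ ψ →
                 Injective _≡_ _≡_ (col ∘ ψ) → RainbowCopy col G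
  rainbow-copy φ φ⁻¹ φ⁻¹∘φ ψ hits rainbow =
    φ , ψ , inverseʳ⇒injective φ (strictlyInverseʳ⇒inverseʳ {f⁻¹ = φ⁻¹} φ φ⁻¹∘φ) , hits , rainbow

  rainbow-ℳ : ∀ {x x′ y y′ z z′} → x ≢ x′ → y ≢ y′ → z ≢ z′ →
              Distinct₃ (col (x , y , z)) (col (x′ , y , z)) (col (x′ , y′ , z′)) → RainbowCopy col ℳ
  rainbow-ℳ {x} {x′} {y} {y′} {z} {z′} x≢x′ y≢y′ z≢z′ distinct =
    rainbow-copy φ φ⁻¹ φ⁻¹∘φ ψ hits (distinct₃⇒injective distinct)
    where
    φ : Fin 6 → KVertex n
    φ 0F = 0F , x
    φ 1F = 1F , y
    φ 2F = 2F , z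
    φ 3F = 0F , x′
    φ 4F = 1F , y′
    φ 5F = 2F , z′

    φ⁻¹ : KVertex n → Fin 6
    φ⁻¹ (0F , i) = if does (i ≟ x) then v₁ else v₄
    φ⁻¹ (1F , i) = if does (i ≟ y) then v₂ else v₅
    φ⁻¹ (2F , i) = if does (i ≟ z) then v₃ else v₆

    φ⁻¹∘φ : ∀ v → φ⁻¹ (φ v) ≡ v
    φ⁻¹∘φ 0F rewrite dec-true (x ≟ x) refl = refl
    φ⁻¹∘φ 1F rewrite dec-true (y ≟ y) refl = refl
    φ⁻¹∘φ 2F rewrite dec-true (z ≟ z) refl = refl
    φ⁻¹∘φ 3F rewrite dec-false (x′ ≟ x) (x≢x′ ∘ sym) = refl
    φ⁻¹∘φ 4F rewrite dec-false (y′ ≟ y) (y≢y′ ∘ sym) = refl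
    φ⁻¹∘φ 5F rewrite dec-false (z′ ≟ z) (z≢z′ ∘ sym) = refl

    ψ : Fin 3 → KEdge n
    ψ 0F = x , y , z
    ψ 1F = x′ , y , z
    ψ 2F = x′ , y′ , z′

    hits : EdgesHit ℳ φ ψ
    hits 0F = inj₁ refl , inj₂ (inj₁ refl) , inj₂ (inj₂ refl)
    hits 1F = inj₂ (inj₁ refl) , inj₂ (inj₂ refl) , inj₁ refl
    hits 2F = inj₁ refl , inj₂ (inj₁ refl) , inj₂ (inj₂ refl)

  rainbow-𝒯 : ∀ {x x′ y y′ z} → x ≢ x′ → y ≢ y′ →
              Distinct₃ (col (x , y , z)) (col (x′ , y , z)) (col (x′ , y′ , z)) → RainbowCopy col 𝒯
  rainbow-𝒯 {x} {x′} {y} {y′} {z} x≢x′ y≢y′ distinct =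
    rainbow-copy φ φ⁻¹ φ⁻¹∘φ ψ hits (distinct₃⇒injective distinct)
    where
    φ : Fin 5 → KVertex n
    φ 0F = 0F , x
    φ 1F = 1F , y
    φ 2F = 2F , z
    φ 3F = 0F , x′
    φ 4F = 1F , y′

    φ⁻¹ : KVertex n → Fin 5
    φ⁻¹ (0F , i) = if does (i ≟ x) then v₁ else v₄
    φ⁻¹ (1F , i) = if does (i ≟ y) then v₂ else v₅
    φ⁻¹ (2F , _) = v₃

    φ⁻¹∘φ : ∀ v → φ⁻¹ (φ v) ≡ v
    φ⁻¹∘φ 0F rewrite dec-true (x ≟ x) refl = refl
    φ⁻¹∘φ 1F rewrite dec-true (y ≟ y) refl = refl
    φ⁻¹∘φ 2F = refl
    φ⁻¹∘φ 3F rewrite dec-false (x′ ≟ x) (x≢x′ ∘ sym) = refl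
    φ⁻¹∘φ 4F rewrite dec-false (y′ ≟ y) (y≢y′ ∘ sym) = refl

    ψ : Fin 3 → KEdge n
    ψ 0F = x , y , z
    ψ 1F = x′ , y , z
    ψ 2F = x′ , y′ , z

    hits : EdgesHit 𝒯 φ ψ
    hits 0F = inj₁ refl , inj₂ (inj₁ refl) , inj₂ (inj₂ refl)
    hits 1F = inj₂ (inj₁ refl) , inj₂ (inj₂ refl) , inj₁ refl
    hits 2F = inj₂ (inj₂ refl) , inj₁ refl , inj₂ (inj₁ refl)

  rainbow-ℒ : ∀ {x x′ y y′ z₁ z₂ z₃} → x ≢ x′ → y′ ≢ y → Distinct₃ z₁ z₂ z₃ →
              Distinct₃ (col (x , y′ , z₁)) (col (x , y , z₂)) (col (x′ , y , z₃)) → RainbowCopy col ℒ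
  rainbow-ℒ {x} {x′} {y} {y′} {z₁} {z₂} {z₃} x≢x′ y′≢y (z₁≢z₂ , z₁≢z₃ , z₂≢z₃) distinct =
    rainbow-copy φ φ⁻¹ φ⁻¹∘φ ψ hits (distinct₃⇒injective distinct)
    where
    φ : Fin 7 → KVertex n
    φ 0F = 1F , y′
    φ 1F = 2F , z₁
    φ 2F = 0F , x
    φ 3F = 2F , z₂
    φ 4F = 1F , y
    φ 5F = 0F , x′
    φ 6F = 2F , z₃

    φ⁻¹ : KVertex n → Fin 7
    φ⁻¹ (0F , i) = if does (i ≟ x) then v₃ else v₆
    φ⁻¹ (1F , i) = if does (i ≟ y′) then v₁ else v₅
    φ⁻¹ (2F , i) = if does (i ≟ z₁) then v₂ else if does (i ≟ z₂) then v₄ else v₇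

    φ⁻¹∘φ : ∀ v → φ⁻¹ (φ v) ≡ v
    φ⁻¹∘φ 0F rewrite dec-true (y′ ≟ y′) refl = refl
    φ⁻¹∘φ 1F rewrite dec-true (z₁ ≟ z₁) refl = refl
    φ⁻¹∘φ 2F rewrite dec-true (x ≟ x) refl = refl
    φ⁻¹∘φ 3F rewrite dec-false (z₂ ≟ z₁) (z₁≢z₂ ∘ sym) | dec-true (z₂ ≟ z₂) refl = refl
    φ⁻¹∘φ 4F rewrite dec-false (y ≟ y′) (y′≢y ∘ sym) = refl
    φ⁻¹∘φ 5F rewrite dec-false (x′ ≟ x) (x≢x′ ∘ sym) = refl
    φ⁻¹∘φ 6F rewrite dec-false (z₃ ≟ z₁) (z₁≢z₃ ∘ sym) | dec-false (z₃ ≟ z₂) (z₂≢z₃ ∘ sym) = refl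

    ψ : Fin 3 → KEdge n
    ψ 0F = x , y′ , z₁
    ψ 1F = x , y , z₂
    ψ 2F = x′ , y , z₃

    hits : EdgesHit ℒ φ ψ
    hits 0F = inj₂ (inj₁ refl) , inj₂ (inj₂ refl) , inj₁ refl
    hits 1F = inj₁ refl , inj₂ (inj₂ refl) , inj₂ (inj₁ refl)
    hits 2F = inj₂ (inj₁ refl) , inj₁ refl , inj₂ (inj₂ refl)

-- Counting colours

module _ {n : ℕ} (col : Colouring n) where

  uses-mono : ∀ {j k} → j ≤ k → UsesAtLeast col k → UsesAtLeast col j
  uses-mono j≤k (f , injective) =
    (λ i → f (Fin.inject≤ i j≤k)) , λ eq → Finₚ.inject≤-injective j≤k j≤k _ _ (injective eq)

  fresh-colour : ∀ {m k} → m < k → UsesAtLeast col k → (c : Fin m → ℕ) → Σ[ e ∈ KEdge n ] (∀ l → col e ≢ c l)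
  fresh-colour {m} {k} m<k (f , injective) c with Finₚ.any? (λ i → Finₚ.all? (λ l → ¬? (col (f i) ℕ.≟ c l)))
  ... | yes (i , avoids) = f i , avoids
  ... | no none = ⊥-elim (ℕₚ.<⇒≱ m<k (Finₚ.injective⇒≤ class-injective))
    where
    class : ∀ i → Σ[ l ∈ Fin m ] col (f i) ≡ c l
    class i with Finₚ.any? (λ l → col (f i) ℕ.≟ c l)
    ... | yes found  = found
    ... | no missing = ⊥-elim (none (i , λ l eq → missing (l , eq)))

    class-injective : Injective _≡_ _≡_ (proj₁ ∘ class)
    class-injective {i} {j} eq = injective (trans (proj₂ (class i)) (trans (cong c eq) (sym (proj₂ (class j)))))

  few-colours : ∀ {A : Set} {m k} → m < k → UsesAtLeast col k → (c : Fin m → ℕ) →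
                (∀ e → A ⊎ Σ[ l ∈ Fin m ] col e ≡ c l) → A
  few-colours m<k uses c classify with fresh-colour m<k uses c
  ... | e , avoids with classify e
  ... | inj₁ a        = a
  ... | inj₂ (l , eq) = ⊥-elim (avoids l eq)

  fresh-colour₂ : ∀ {k} → 2 < k → UsesAtLeast col k → ∀ a b → Σ[ e ∈ KEdge n ] ¬ OneOf a b (col e)
  fresh-colour₂ 2<k uses a b with fresh-colour 2<k uses (λ { 0F → a ; 1F → b })
  ... | e , avoids = e , λ { (inj₁ e≡a) → avoids 0F e≡a ; (inj₂ e≡b) → avoids 1F e≡b }

  two-colours : UsesAtLeast col 2 → Σ[ e ∈ KEdge n ] Σ[ e′ ∈ KEdge n ] col e ≢ col e′
  two-colours (f , injective) = f 0F , f 1F , λ eq → case injective eq of λ ()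

  lower-bound : ∀ {G m} → UsesAtLeast col m → ¬ RainbowCopy col G → ∀ k → Forces n G k → m < k
  lower-bound {m = m} uses no-copy k forces with m ℕ.<? k
  ... | yes m<k = m<k
  ... | no m≮k  = ⊥-elim (no-copy (forces col (uses-mono (ℕₚ.≮⇒≥ m≮k) uses)))

same-first-coordinate : ∀ {n k} → n < k → (f : Fin k → KEdge n) → ∃₂ λ i j → i ≢ j × proj₁ (f i) ≡ proj₁ (f j)
same-first-coordinate n<k f with Finₚ.pigeonhole n<k (proj₁ ∘ f)
... | i , j , i<j , eq = i , j , Finₚ.<⇒≢ i<j , eq

bichromatic-line : ∀ {n} (col : Colouring n) {e e′} → col e ≢ col e′ →
  ∃ λ (π : Permutation′ 3) → ∃₂ λ x x′ → ∃₂ λ y z → col (permute π (x , y , z)) ≢ col (permute π (x′ , y , z))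
bichromatic-line col {a₀ , b₀ , c₀} {a₁ , b₁ , c₁} e≢e′
  with col (a₀ , b₀ , c₀) ℕ.≟ col (a₁ , b₀ , c₀) | col (a₁ , b₀ , c₀) ℕ.≟ col (a₁ , b₁ , c₀)
... | no step₀  | _         = Perm.id , a₀ , a₁ , b₀ , c₀ , step₀
... | yes _     | no step₁  = swap₀₁ , b₀ , b₁ , a₁ , c₀ , step₁
... | yes same₀ | yes same₁ = swap₀₂ , c₀ , c₁ , b₁ , a₁ , λ step₂ → e≢e′ (trans same₀ (trans same₁ step₂))

-- Lower bounds

first-coordinate-colouring : ∀ {n} → Colouring n
first-coordinate-colouring = toℕ ∘ proj₁

first-coordinate-colouring-uses : ∀ {n} → UsesAtLeast (first-coordinate-colouring {n}) n
first-coordinate-colouring-uses = (λ i → i , i , i) , Finₚ.toℕ-injective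

no-rainbow-ℳ : ∀ {n} → ¬ RainbowCopy (first-coordinate-colouring {n}) ℳ
no-rainbow-ℳ {n} (φ , ψ , φ-injective , hits , rainbow) =
  shared-with-ψ₁ (∈KE-cover w∈ψ₁ (proj₁ (hits 1F)) (proj₁ (proj₂ (hits 1F))) (proj₂ (proj₂ (hits 1F)))
                   (Distinct₃-map φ-injective ((λ ()) , (λ ()) , (λ ()))))
  where
  w : KVertex n
  w = 0F , proj₁ (ψ 1F)

  w∈ψ₁ : w ∈KE ψ 1F
  w∈ψ₁ = coord∈KE (ψ 1F) 0F

  only-ψ₁ : ∀ {j} → w ∈KE ψ j → j ≡ 1F
  only-ψ₁ w∈ψⱼ = rainbow (cong toℕ (sym (∈KE⇒coord w∈ψⱼ)))

  shared-with-ψ₁ : w ≡ φ 1F ⊎ w ≡ φ 2F ⊎ w ≡ φ 3F → ⊥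
  shared-with-ψ₁ (inj₁ w≡φv₂) =
    case only-ψ₁ (subst (_∈KE ψ 0F) (sym w≡φv₂) (proj₁ (proj₂ (hits 0F)))) of λ ()
  shared-with-ψ₁ (inj₂ (inj₁ w≡φv₃)) =
    case only-ψ₁ (subst (_∈KE ψ 0F) (sym w≡φv₃) (proj₂ (proj₂ (hits 0F)))) of λ ()
  shared-with-ψ₁ (inj₂ (inj₂ w≡φv₄)) =
    case only-ψ₁ (subst (_∈KE ψ 2F) (sym w≡φv₄) (proj₁ (hits 2F))) of λ ()

module _ {n : ℕ} {P : KEdge n → Set} (P? : Decidable P) where

  marked-colouring : Colouring n
  marked-colouring e = if does (P? e) then toℕ (proj₁ e) else n

  unmarked-colour : ∀ {e} → ¬ P e → marked-colouring e ≡ n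
  unmarked-colour {e} ¬Pe rewrite dec-false (P? e) ¬Pe = refl

  marked-colour : ∀ {e} → P e → marked-colouring e ≡ toℕ (proj₁ e)
  marked-colour {e} Pe rewrite dec-true (P? e) Pe = refl

  colour≢n⇒marked : ∀ {e} → marked-colouring e ≢ n → P e
  colour≢n⇒marked {e} ≢n with P? e
  ... | yes Pe = Pe
  ... | no  _  = ⊥-elim (≢n refl)

  marked-colouring-uses : (r : Fin n → Fin n × Fin n) → (∀ i → P (i , r i)) → Σ[ o ∈ KEdge n ] ¬ P o →
                          UsesAtLeast marked-colouring (ℕ.suc n)
  marked-colouring-uses r marked (o , ¬Po) = f , injective
    where
    f : Fin (ℕ.suc n) → KEdge n
    f 0F      = o
    f (suc i) = i , r i

    injective : Injective _≡_ _≡_ (marked-colouring ∘ f)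
    injective {0F}    {0F}    _  = refl
    injective {0F}    {suc j} eq = ⊥-elim (ℕₚ.<⇒≢ (Finₚ.toℕ<n j)
      (trans (sym (marked-colour (marked j))) (trans (sym eq) (unmarked-colour ¬Po))))
    injective {suc i} {0F}    eq = ⊥-elim (ℕₚ.<⇒≢ (Finₚ.toℕ<n i)
      (trans (sym (marked-colour (marked i))) (trans eq (unmarked-colour ¬Po))))
    injective {suc i} {suc j} eq = cong suc (Finₚ.toℕ-injective
      (trans (sym (marked-colour (marked i))) (trans eq (marked-colour (marked j)))))

diagonal : ∀ {n} → Fin n → KEdge n
diagonal a = a , a , a

Diagonal : ∀ {n} → KEdge n → Set
Diagonal e = e ≡ diagonal (proj₁ e)

diagonal? : ∀ {n} → Decidable (Diagonal {n})
diagonal? e = Productₚ.≡-dec _≟_ (Productₚ.≡-dec _≟_ _≟_) e (diagonal (proj₁ e))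

coord-diagonal : ∀ {n} (a : Fin n) k → coord (diagonal a) k ≡ a
coord-diagonal a 0F = refl
coord-diagonal a 1F = refl
coord-diagonal a 2F = refl

diagonal-∈KE : ∀ {n} {e : KEdge n} {x} → Diagonal e → x ∈KE e → proj₂ x ≡ proj₁ e
diagonal-∈KE {e = e} {x} e-diagonal x∈e =
  trans (∈KE⇒coord x∈e) (trans (cong (λ d → coord d (proj₁ x)) e-diagonal) (coord-diagonal (proj₁ e) (proj₁ x)))

diagonals-meet-once : ∀ {n} {e e′ : KEdge n} {x} → Diagonal e → Diagonal e′ → x ∈KE e → x ∈KE e′ → e ≡ e′
diagonals-meet-once {e = e} {e′} e-diagonal e′-diagonal x∈e x∈e′ = begin
  e                    ≡⟨ e-diagonal ⟩
  diagonal (proj₁ e)   ≡⟨ cong diagonal (trans (sym (diagonal-∈KE e-diagonal x∈e))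
                                               (diagonal-∈KE e′-diagonal x∈e′)) ⟩
  diagonal (proj₁ e′)  ≡⟨ sym e′-diagonal ⟩
  e′                   ∎
  where open ≡-Reasoning

no-rainbow-𝒯 : ∀ {n} → ¬ RainbowCopy (marked-colouring (diagonal? {n})) 𝒯
no-rainbow-𝒯 {n} (φ , ψ , _ , hits , rainbow) =
  two-diagonal (two-avoiding (col ∘ ψ) (injective⇒distinct₃ rainbow) n)
  where
  col : Colouring n
  col = marked-colouring diagonal?

  centre : ∀ j → φ 2F ∈KE ψ j
  centre 0F = proj₂ (proj₂ (hits 0F))
  centre 1F = proj₁ (proj₂ (hits 1F))
  centre 2F = proj₁ (hits 2F)

  two-diagonal : (Σ[ p ∈ Fin 3 ] Σ[ q ∈ Fin 3 ] col (ψ p) ≢ n × col (ψ q) ≢ n × col (ψ p) ≢ col (ψ q)) → ⊥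
  two-diagonal (p , q , p≢n , q≢n , p≢q) = p≢q (cong col
    (diagonals-meet-once (colour≢n⇒marked diagonal? p≢n) (colour≢n⇒marked diagonal? q≢n) (centre p) (centre q)))

Linear : Hyp3 → Set
Linear G = ∀ i j u w → i ≢ j → u ∈ᵉ edge i → u ∈ᵉ edge j → w ∈ᵉ edge i → w ∈ᵉ edge j → u ≡ w
  where open Hyp3 G

ℒ-linear : Linear ℒ
ℒ-linear = toWitness {a? = Finₚ.all? λ i → Finₚ.all? λ j → Finₚ.all? λ u → Finₚ.all? λ w →
  ¬? (i ≟ j) →-dec u ∈ᵉ? edge i →-dec u ∈ᵉ? edge j →-dec w ∈ᵉ? edge i →-dec w ∈ᵉ? edge j →-dec u ≟ w} _
  where
  open Hyp3 ℒ
  _∈ᵉ?_ : ∀ u e → Dec (u ∈ᵉ e)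
  u ∈ᵉ? (a , b , c) = u ≟ a ⊎-dec u ≟ b ⊎-dec u ≟ c

ℒ-edges-distinct : ∀ j → let (a , b , c) = Hyp3.edge ℒ j in Distinct₃ a b c
ℒ-edges-distinct 0F = (λ ()) , (λ ()) , (λ ())
ℒ-edges-distinct 1F = (λ ()) , (λ ()) , (λ ())
ℒ-edges-distinct 2F = (λ ()) , (λ ()) , (λ ())

module _ {n : ℕ} (z : Fin n) where

  OnBaseLine : KEdge n → Set
  OnBaseLine e = proj₂ e ≡ (z , z)

  on-base-line? : Decidable OnBaseLine
  on-base-line? e = Productₚ.≡-dec _≟_ _≟_ (proj₂ e) (z , z)

  base-line-vertices : ∀ {e} → OnBaseLine e → (1F , z) ∈KE e × (2F , z) ∈KE e
  base-line-vertices {_ , _ , _} refl = inj₂ (inj₁ refl) , inj₂ (inj₂ refl)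

  no-rainbow-ℒ : ¬ RainbowCopy (marked-colouring on-base-line?) ℒ
  no-rainbow-ℒ (φ , ψ , φ-injective , hits , rainbow) =
    two-on-base-line (two-avoiding (col ∘ ψ) (injective⇒distinct₃ rainbow) n)
    where
    open Hyp3 ℒ

    col : Colouring n
    col = marked-colouring on-base-line?

    preimage : ∀ {j x} → x ∈KE ψ j → Σ[ u ∈ Fin 7 ] u ∈ᵉ edge j × x ≡ φ u
    preimage {j} = ∈KE-image φ-injective (ℒ-edges-distinct j)
                     (proj₁ (hits j)) (proj₁ (proj₂ (hits j))) (proj₂ (proj₂ (hits j)))

    common-preimage : ∀ {p q x} → x ∈KE ψ p → x ∈KE ψ q → Σ[ u ∈ Fin 7 ] u ∈ᵉ edge p × u ∈ᵉ edge q × x ≡ φ u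
    common-preimage {p} {q} {x} x∈ψp x∈ψq = merge (preimage x∈ψp) (preimage x∈ψq)
      where
      merge : Σ[ u ∈ Fin 7 ] u ∈ᵉ edge p × x ≡ φ u → Σ[ u ∈ Fin 7 ] u ∈ᵉ edge q × x ≡ φ u →
              Σ[ u ∈ Fin 7 ] u ∈ᵉ edge p × u ∈ᵉ edge q × x ≡ φ u
      merge (u , u∈p , x≡φu) (u′ , u′∈q , x≡φu′) =
        u , u∈p , subst (_∈ᵉ edge q) (φ-injective (trans (sym x≡φu′) x≡φu)) u′∈q , x≡φu

    two-on-base-line : (Σ[ p ∈ Fin 3 ] Σ[ q ∈ Fin 3 ] col (ψ p) ≢ n × col (ψ q) ≢ n × col (ψ p) ≢ col (ψ q)) → ⊥
    two-on-base-line (p , q , p≢n , q≢n , p≢q) =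
      collapse (common-preimage (proj₁ on-p) (proj₁ on-q)) (common-preimage (proj₂ on-p) (proj₂ on-q))
      where
      on-p : (1F , z) ∈KE ψ p × (2F , z) ∈KE ψ p
      on-p = base-line-vertices (colour≢n⇒marked on-base-line? p≢n)

      on-q : (1F , z) ∈KE ψ q × (2F , z) ∈KE ψ q
      on-q = base-line-vertices (colour≢n⇒marked on-base-line? q≢n)

      1F≢2F : 1F ≢ 2F
      1F≢2F ()

      collapse : Σ[ u ∈ Fin 7 ] u ∈ᵉ edge p × u ∈ᵉ edge q × (1F , z) ≡ φ u →
                 Σ[ w ∈ Fin 7 ] w ∈ᵉ edge p × w ∈ᵉ edge q × (2F , z) ≡ φ w → ⊥
      collapse (u , u∈p , u∈q , y≡φu) (w , w∈p , w∈q , z≡φw) = 1F≢2F (cong proj₁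
        (trans y≡φu (trans (cong φ (ℒ-linear p q u w (p≢q ∘ cong (col ∘ ψ)) u∈p u∈q w∈p w∈q)) (sym z≡φw))))

ℳ-lower : ∀ {n} k → Forces n ℳ k → n + 1 ≤ k
ℳ-lower {n} k forces = subst (_≤ k) (ℕₚ.+-comm 1 n)
  (lower-bound first-coordinate-colouring first-coordinate-colouring-uses no-rainbow-ℳ k forces)

𝒯-lower : ∀ {n} → 2 ≤ n → ∀ k → Forces n 𝒯 k → n + 2 ≤ k
𝒯-lower {n} (s≤s (s≤s _)) k forces = subst (_≤ k) (ℕₚ.+-comm 2 n)
  (lower-bound (marked-colouring diagonal?)
     (marked-colouring-uses diagonal? (λ i → i , i) (λ _ → refl) ((0F , 1F , 0F) , λ ()))
     no-rainbow-𝒯 k forces)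

ℒ-lower : ∀ {n} → 2 ≤ n → ∀ k → Forces n ℒ k → n + 2 ≤ k
ℒ-lower {n} (s≤s (s≤s _)) k forces = subst (_≤ k) (ℕₚ.+-comm 2 n)
  (lower-bound (marked-colouring (on-base-line? 0F))
     (marked-colouring-uses (on-base-line? 0F) (λ _ → 0F , 0F) (λ _ → refl) ((0F , 1F , 0F) , λ ()))
     (no-rainbow-ℒ 0F) k forces)

-- Upper bound for ℳ

module ℳ-upper {n : ℕ} (3≤n : 3 ≤ n) where

  n<n+1 : n < n + 1
  n<n+1 = ℕₚ.m<m+n n (s≤s z≤n)

  2<n+1 : 2 < n + 1
  2<n+1 = ℕₚ.≤-trans 3≤n (ℕₚ.m≤m+n n 1)

  off-line-same-colour : ∀ (col : Colouring n) {y z x₁ x₂ x₃} →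
    Distinct₃ (col (x₁ , y , z)) (col (x₂ , y , z)) (col (x₃ , y , z)) →
    ∀ s {t w} → t ≢ y → w ≢ z → RainbowCopy col ℳ ⊎ col (s , t , w) ≡ col (s , y , z)
  off-line-same-colour col {y} {z} distinct s {t} {w} t≢y w≢z with col (s , t , w) ℕ.≟ col (s , y , z)
  ... | yes same = inj₂ same
  ... | no differ with avoiding ℕ._≟_ (λ x → col (x , y , z)) distinct (col (s , y , z)) (col (s , t , w))
  ... | p , p≢s , p≢stw = inj₁ (rainbow-ℳ col (p≢s ∘ cong (λ x → col (x , y , z))) (t≢y ∘ sym) (w≢z ∘ sym)
                                   (p≢s , p≢stw , differ ∘ sym))

  colour-by-first-coordinate : ∀ (col : Colouring n) {y z x₁ x₂ x₃} →
    Distinct₃ (col (x₁ , y , z)) (col (x₂ , y , z)) (col (x₃ , y , z)) →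
    ∀ e → RainbowCopy col ℳ ⊎ col e ≡ col (proj₁ e , y , z)
  colour-by-first-coordinate col {y} {z} {x₁} {x₂} {x₃} distinct (s , t , w)
    with fresh-index 3≤n y t | fresh-index 3≤n z w
  ... | t₀ , t₀≢y , t₀≢t | w₀ , w₀≢z , w₀≢w = do
    same₁ ← off-line-same-colour col distinct x₁ t₀≢y w₀≢z
    same₂ ← off-line-same-colour col distinct x₂ t₀≢y w₀≢z
    same₃ ← off-line-same-colour col distinct x₃ t₀≢y w₀≢z
    same  ← off-line-same-colour col (Distinct₃-respects same₁ same₂ same₃ distinct) s (t₀≢t ∘ sym) (w₀≢w ∘ sym)
    sameₛ ← off-line-same-colour col distinct s t₀≢y w₀≢z
    pure (trans same sameₛ)

  three-coloured-line : ∀ (col : Colouring n) → UsesAtLeast col (n + 1) → ∀ {y z x₁ x₂ x₃} →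
    Distinct₃ (col (x₁ , y , z)) (col (x₂ , y , z)) (col (x₃ , y , z)) → RainbowCopy col ℳ
  three-coloured-line col uses {y} {z} distinct =
    few-colours col n<n+1 uses (λ l → col (l , y , z))
      (λ e → map₂ (proj₁ e ,_) (colour-by-first-coordinate col distinct e))

  module Two-coloured-line (col : Colouring n) {x x′ y z : Fin n} (A≢B : col (x , y , z) ≢ col (x′ , y , z))
           (on-line : ∀ s → OneOf (col (x , y , z)) (col (x′ , y , z)) (col (s , y , z))) where

    A B : ℕ
    A = col (x , y , z)
    B = col (x′ , y , z)

    off-line-in-pair : ∀ s {t w} → t ≢ y → w ≢ z → RainbowCopy col ℳ ⊎ OneOf A B (col (s , t , w))
    off-line-in-pair s {t} {w} t≢y w≢z with one-of? A B (col (s , t , w))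
    ... | yes inside = inj₂ inside
    ... | no outside with the-other (λ u → col (u , y , z)) A≢B (on-line s)
    ... | p , p-inside , p≢s = inj₁ (rainbow-ℳ col (p≢s ∘ cong (λ u → col (u , y , z))) (t≢y ∘ sym) (w≢z ∘ sym)
            (p≢s , ¬OneOf⇒≢ outside p-inside ∘ sym , ¬OneOf⇒≢ outside (on-line s) ∘ sym))

    -- With p the point of the line coloured unlike s, the colour of (p , t₁ , z) decides which copy
    -- of ℳ appears.
    cross-line-in-pair : ∀ s {w} → w ≢ z → RainbowCopy col ℳ ⊎ OneOf A B (col (s , y , w))
    cross-line-in-pair s {w} w≢z with one-of? A B (col (s , y , w))
    ... | yes inside = inj₂ inside
    ... | no outside with the-other (λ u → col (u , y , z)) A≢B (on-line s) | fresh-index 3≤n y y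
    ... | p , p-inside , p≢s | t₁ , t₁≢y , _
      with col (p , t₁ , z) ℕ.≟ col (s , y , w) | col (p , t₁ , z) ℕ.≟ col (s , y , z)
    ... | no K≢C | yes K≡D = inj₁ (rainbow-unpermute col swap₀₁ (rainbow-ℳ (col ∘ permute swap₀₁)
          t₁≢y (p≢s ∘ cong (λ u → col (u , y , z))) (w≢z ∘ sym)
          ((λ eq → p≢s (trans (sym eq) K≡D)) , K≢C , ¬OneOf⇒≢ outside p-inside ∘ sym)))
    ... | no K≢C | no K≢D = inj₁ (rainbow-unpermute col swap₀₂ (rainbow-ℳ (col ∘ permute swap₀₂)
          w≢z (t₁≢y ∘ sym) (p≢s ∘ cong (λ u → col (u , y , z)) ∘ sym)
          (¬OneOf⇒≢ outside (on-line s) , K≢C ∘ sym , K≢D ∘ sym)))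
    ... | yes K≡C | _ with fresh-index 3≤n p s
    ... | s₁ , s₁≢p , s₁≢s = do
      s₁-inside ← off-line-in-pair s₁ t₁≢y w≢z
      inj₁ (via-s₁ s₁-inside)
      where
      via-s₁ : OneOf A B (col (s₁ , t₁ , w)) → RainbowCopy col ℳ
      via-s₁ s₁-inside with col (s₁ , t₁ , w) ℕ.≟ col (s , y , z)
      ... | yes s₁≡D = rainbow-unpermute col swap₀₁ (rainbow-ℳ (col ∘ permute swap₀₁)
            (t₁≢y ∘ sym) (s₁≢p ∘ sym) (w≢z ∘ sym)
            ((λ eq → ¬OneOf⇒≢ outside p-inside (trans (sym K≡C) (sym eq))) ,
             (λ eq → p≢s (trans eq s₁≡D)) ,
             (λ eq → ¬OneOf⇒≢ outside (on-line s) (trans (sym K≡C) (trans eq s₁≡D)))))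
      ... | no s₁≢D = rainbow-unpermute col swap₀₂ (rainbow-ℳ (col ∘ permute swap₀₂)
            (w≢z ∘ sym) (t₁≢y ∘ sym) (s₁≢s ∘ sym)
            (¬OneOf⇒≢ outside (on-line s) ∘ sym , s₁≢D ∘ sym , ¬OneOf⇒≢ outside s₁-inside))

  everywhere-in-pair : ∀ (col : Colouring n) {x x′ y z} (A≢B : col (x , y , z) ≢ col (x′ , y , z)) →
    (∀ s → OneOf (col (x , y , z)) (col (x′ , y , z)) (col (s , y , z))) →
    ∀ e → RainbowCopy col ℳ ⊎ OneOf (col (x , y , z)) (col (x′ , y , z)) (col e)
  everywhere-in-pair col {y = y} {z} A≢B on-line (s , t , w) with t ≟ y | w ≟ z
  ... | yes refl | yes refl = inj₂ (on-line s)
  ... | yes refl | no w≢z   = Two-coloured-line.cross-line-in-pair col A≢B on-line s w≢z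
  ... | no t≢y   | yes refl = map₁ (rainbow-unpermute col swap₁₂)
                                (Two-coloured-line.cross-line-in-pair (col ∘ permute swap₁₂) A≢B on-line s t≢y)
  ... | no t≢y   | no w≢z   = Two-coloured-line.off-line-in-pair col A≢B on-line s t≢y w≢z

  bichromatic-line-forces : ∀ (col : Colouring n) → UsesAtLeast col (n + 1) → ∀ {x x′ y z} →
    col (x , y , z) ≢ col (x′ , y , z) → RainbowCopy col ℳ
  bichromatic-line-forces col uses {x} {x′} {y} {z} A≢B
    with Finₚ.any? (λ s → ¬? (one-of? (col (x , y , z)) (col (x′ , y , z)) (col (s , y , z))))
  ... | yes (s , outside) = three-coloured-line col uses
          (A≢B , ¬OneOf⇒≢ outside (inj₁ refl) ∘ sym , ¬OneOf⇒≢ outside (inj₂ refl) ∘ sym)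
  ... | no none with fresh-colour₂ col 2<n+1 uses (col (x , y , z)) (col (x′ , y , z))
  ... | e , outside = fromInj₁ (⊥-elim ∘ outside) (everywhere-in-pair col A≢B on-line e)
    where
    on-line : ∀ s → OneOf (col (x , y , z)) (col (x′ , y , z)) (col (s , y , z))
    on-line s = decidable-stable (one-of? _ _ _) (λ outside → none (s , outside))

  ℳ-forced : Forces n ℳ (n + 1)
  ℳ-forced col uses with two-colours col (uses-mono col (ℕₚ.<⇒≤ 2<n+1) uses)
  ... | _ , _ , e≢e′ with bichromatic-line col e≢e′
  ... | π , _ , _ , _ , _ , line = rainbow-unpermute col π
          (bichromatic-line-forces (col ∘ permute π) (uses-permute col π uses) line)

-- Upper bound for 𝒯

module 𝒯-upper {n : ℕ} (3≤n : 3 ≤ n) where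

  n<n+2 : n < n + 2
  n<n+2 = ℕₚ.m<m+n n (s≤s z≤n)

  4<n+2 : 4 < n + 2
  4<n+2 = ℕₚ.+-monoˡ-≤ 2 3≤n

  row-same-colour : ∀ (col : Colouring n) {y z x₁ x₂ x₃} →
    Distinct₃ (col (x₁ , y , z)) (col (x₂ , y , z)) (col (x₃ , y , z)) →
    ∀ s t → RainbowCopy col 𝒯 ⊎ col (s , t , z) ≡ col (s , y , z)
  row-same-colour col {y} {z} distinct s t with t ≟ y
  ... | yes refl = inj₂ refl
  ... | no t≢y with col (s , t , z) ℕ.≟ col (s , y , z)
  ... | yes same = inj₂ same
  ... | no differ with avoiding ℕ._≟_ (λ x → col (x , y , z)) distinct (col (s , y , z)) (col (s , t , z))
  ... | p , p≢s , p≢stz = inj₁ (rainbow-unpermute col swap₀₁ (rainbow-𝒯 (col ∘ permute swap₀₁)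
          t≢y (p≢s ∘ cong (λ x → col (x , y , z)) ∘ sym) (differ , p≢stz ∘ sym , p≢s ∘ sym)))

  colour-by-first-coordinate : ∀ (col : Colouring n) {y z x₁ x₂ x₃} →
    Distinct₃ (col (x₁ , y , z)) (col (x₂ , y , z)) (col (x₃ , y , z)) →
    ∀ e → RainbowCopy col 𝒯 ⊎ col e ≡ col (proj₁ e , y , z)
  colour-by-first-coordinate col {y} {z} {x₁} {x₂} {x₃} distinct (s , t , w) = do
    same₁ ← row-same-colour col distinct x₁ t
    same₂ ← row-same-colour col distinct x₂ t
    same₃ ← row-same-colour col distinct x₃ t
    same  ← map₁ (rainbow-unpermute col swap₁₂)
               (row-same-colour (col ∘ permute swap₁₂) (Distinct₃-respects same₁ same₂ same₃ distinct) s w)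
    sameₛ ← row-same-colour col distinct s t
    pure (trans same sameₛ)

  three-coloured-line : ∀ (col : Colouring n) → UsesAtLeast col (n + 2) → ∀ {y z x₁ x₂ x₃} →
    Distinct₃ (col (x₁ , y , z)) (col (x₂ , y , z)) (col (x₃ , y , z)) → RainbowCopy col 𝒯
  three-coloured-line col uses {y} {z} distinct =
    few-colours col n<n+2 uses (λ l → col (l , y , z))
      (λ e → map₂ (proj₁ e ,_) (colour-by-first-coordinate col distinct e))

  row-in-pair : ∀ (col : Colouring n) → UsesAtLeast col (n + 2) → ∀ {a t₁ t₂ w} →
    col (a , t₁ , w) ≢ col (a , t₂ , w) →
    ∀ t w′ → RainbowCopy col 𝒯 ⊎ OneOf (col (a , t₁ , w)) (col (a , t₂ , w)) (col (a , t , w′))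
  row-in-pair col uses {a} {t₁} {t₂} {w} A≢B t w′
    with one-of? (col (a , t₁ , w)) (col (a , t₂ , w)) (col (a , t , w))
  ... | no outside = inj₁ (rainbow-unpermute col swap₀₁ (three-coloured-line (col ∘ permute swap₀₁)
          (uses-permute col swap₀₁ uses)
          (A≢B , ¬OneOf⇒≢ outside (inj₁ refl) ∘ sym , ¬OneOf⇒≢ outside (inj₂ refl) ∘ sym)))
  ... | yes inside with w′ ≟ w
  ... | yes refl = inj₂ inside
  ... | no w′≢w with one-of? (col (a , t₁ , w)) (col (a , t₂ , w)) (col (a , t , w′))
  ... | yes inside′ = inj₂ inside′
  ... | no outside′ with the-other (λ u → col (a , u , w)) A≢B inside
  ... | t′ , t′-inside , t′≢t = inj₁ (rainbow-unpermute col swap₀₂ (rainbow-𝒯 (col ∘ permute swap₀₂)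
          w′≢w (t′≢t ∘ cong (λ u → col (a , u , w)) ∘ sym)
          (¬OneOf⇒≢ outside′ inside , ¬OneOf⇒≢ outside′ t′-inside , t′≢t ∘ sym)))

  column-in-pair : ∀ (col : Colouring n) → UsesAtLeast col (n + 2) → ∀ {a t w₁ w₂} →
    col (a , t , w₁) ≢ col (a , t , w₂) →
    ∀ t′ w → RainbowCopy col 𝒯 ⊎ OneOf (col (a , t , w₁)) (col (a , t , w₂)) (col (a , t′ , w))
  column-in-pair col uses A≢B t′ w =
    map₁ (rainbow-unpermute col swap₁₂)
         (row-in-pair (col ∘ permute swap₁₂) (uses-permute col swap₁₂ uses) A≢B w t′)

  three-coloured-plane : ∀ (col : Colouring n) → UsesAtLeast col (n + 2) → ∀ {e₁ e₂ e₃} →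
    proj₁ e₁ ≡ proj₁ e₂ → proj₁ e₁ ≡ proj₁ e₃ → Distinct₃ (col e₁) (col e₂) (col e₃) → RainbowCopy col 𝒯
  three-coloured-plane col uses {a , t₁ , w₁} {_ , t₂ , w₂} {_ , t₃ , w₃} refl refl distinct@(c₁≢c₂ , _ , _)
    with col (a , t₁ , w₂) ℕ.≟ col (a , t₁ , w₁)
  ... | no D≢c₁ = fromInj₁ ⊥-elim (do
    inside₂ ← column-in-pair col uses (D≢c₁ ∘ sym) t₂ w₂
    inside₃ ← column-in-pair col uses (D≢c₁ ∘ sym) t₃ w₃
    pure (pair-excludes-third distinct inside₂ inside₃))
  ... | yes D≡c₁ = fromInj₁ ⊥-elim (do
    inside₃ ← row-in-pair col uses (c₁≢c₂ ∘ trans (sym D≡c₁)) t₃ w₃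
    pure (pair-excludes-third distinct (inj₂ refl)
            (subst (λ d → OneOf d (col (a , t₂ , w₂)) (col (a , t₃ , w₃))) D≡c₁ inside₃)))

  two-coloured-plane : ∀ (col : Colouring n) → UsesAtLeast col (n + 2) → ∀ {e₁ e₂} →
    col e₁ ≢ col e₂ → proj₁ e₁ ≡ proj₁ e₂ →
    ∀ e → proj₁ e₁ ≡ proj₁ e → RainbowCopy col 𝒯 ⊎ OneOf (col e₁) (col e₂) (col e)
  two-coloured-plane col uses {e₁} {e₂} c₁≢c₂ e₁~e₂ e e₁~e with one-of? (col e₁) (col e₂) (col e)
  ... | yes inside = inj₂ inside
  ... | no outside = inj₁ (three-coloured-plane col uses e₁~e₂ e₁~e
          (c₁≢c₂ , ¬OneOf⇒≢ outside (inj₁ refl) ∘ sym , ¬OneOf⇒≢ outside (inj₂ refl) ∘ sym))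

  -- The line through an edge of a fifth colour meets both planes in edges of the planes' colours.
  two-coloured-planes : ∀ (col : Colouring n) → UsesAtLeast col (n + 2) → ∀ {e₁ e₂ e₃ e₄} →
    Distinct₄ (col e₁) (col e₂) (col e₃) (col e₄) → proj₁ e₁ ≡ proj₁ e₂ → proj₁ e₃ ≡ proj₁ e₄ →
    RainbowCopy col 𝒯
  two-coloured-planes col uses {e₁} {e₂} {e₃} {e₄} ((≢₁₂ , ≢₁₃ , ≢₂₃) , ≢₁₄ , ≢₂₄ , ≢₃₄) e₁~e₂ e₃~e₄
    with fresh-colour col 4<n+2 uses (λ { 0F → col e₁ ; 1F → col e₂ ; 2F → col e₃ ; 3F → col e₄ })
  ... | (k₀ , k₁ , k₂) , fresh = fromInj₁ (three-coloured-line col uses) (do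
    inside₁ ← two-coloured-plane col uses ≢₁₂ e₁~e₂ (proj₁ e₁ , k₁ , k₂) refl
    inside₂ ← two-coloured-plane col uses ≢₃₄ e₃~e₄ (proj₁ e₃ , k₁ , k₂) refl
    pure (separated inside₁ inside₂ , fresh₁₂ inside₁ , fresh₃₄ inside₂))
    where
    separated : ∀ {u v} → OneOf (col e₁) (col e₂) u → OneOf (col e₃) (col e₄) v → u ≢ v
    separated (inj₁ refl) (inj₁ refl) = ≢₁₃
    separated (inj₁ refl) (inj₂ refl) = ≢₁₄
    separated (inj₂ refl) (inj₁ refl) = ≢₂₃
    separated (inj₂ refl) (inj₂ refl) = ≢₂₄

    fresh₁₂ : ∀ {u} → OneOf (col e₁) (col e₂) u → u ≢ col (k₀ , k₁ , k₂)
    fresh₁₂ (inj₁ refl) = fresh 0F ∘ sym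
    fresh₁₂ (inj₂ refl) = fresh 1F ∘ sym

    fresh₃₄ : ∀ {u} → OneOf (col e₃) (col e₄) u → u ≢ col (k₀ , k₁ , k₂)
    fresh₃₄ (inj₁ refl) = fresh 2F ∘ sym
    fresh₃₄ (inj₂ refl) = fresh 3F ∘ sym

  𝒯-forced : Forces n 𝒯 (n + 2)
  𝒯-forced col uses with uses-mono col (ℕₚ.≤-reflexive (ℕₚ.+-comm 2 n)) uses
  ... | f , f-rainbow with same-first-coordinate (ℕₚ.m<n+m n {2} (s≤s z≤n)) f
  ... | i , j , i≢j , i~j with same-first-coordinate (ℕₚ.n<1+n n) (f ∘ punchIn i)
  ... | p , q , p≢q , p~q = planes (proj₁ (f (punchIn i p)) ≟ proj₁ (f i))
    where
    i≢p : i ≢ punchIn i p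
    i≢p = Finₚ.punchInᵢ≢i i p ∘ sym

    i≢q : i ≢ punchIn i q
    i≢q = Finₚ.punchInᵢ≢i i q ∘ sym

    p≢q′ : punchIn i p ≢ punchIn i q
    p≢q′ = p≢q ∘ Finₚ.punchIn-injective i p q

    planes : Dec (proj₁ (f (punchIn i p)) ≡ proj₁ (f i)) → RainbowCopy col 𝒯
    planes (yes p~i) = three-coloured-plane col uses (sym p~i) (trans (sym p~i) p~q)
      (Distinct₃-map f-rainbow (i≢p , i≢q , p≢q′))
    planes (no p≁i) = two-coloured-planes col uses
      (Distinct₄-map f-rainbow ((i≢j , i≢p , j≢p) , i≢q , j≢q , p≢q′)) i~j p~q
      where
      j≢p : j ≢ punchIn i p
      j≢p j≡p = p≁i (trans (cong (proj₁ ∘ f) (sym j≡p)) (sym i~j))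

      j≢q : j ≢ punchIn i q
      j≢q j≡q = p≁i (trans p~q (trans (cong (proj₁ ∘ f) (sym j≡q)) (sym i~j)))

-- Upper bound for ℒ

module _ {n : ℕ} where

  Disjoint : KEdge n → KEdge n → Set
  Disjoint (a , b , c) (a′ , b′ , c′) = a ≢ a′ × b ≢ b′ × c ≢ c′

  Disjoint-sym : ∀ {e e′} → Disjoint e e′ → Disjoint e′ e
  Disjoint-sym {_ , _ , _} {_ , _ , _} (d₀ , d₁ , d₂) = d₀ ∘ sym , d₁ ∘ sym , d₂ ∘ sym

  _[_]≔_ : KEdge n → Fin 3 → Fin n → KEdge n
  (a , b , c) [ 0F ]≔ v = v , b , c
  (a , b , c) [ 1F ]≔ v = a , v , c
  (a , b , c) [ 2F ]≔ v = a , b , v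

  update-coord : ∀ e i → e [ i ]≔ coord e i ≡ e
  update-coord _ 0F = refl
  update-coord _ 1F = refl
  update-coord _ 2F = refl

  Near : KEdge n → KEdge n → Set
  Near p g = Σ[ i ∈ Fin 3 ] Σ[ v ∈ Fin n ] g ≡ p [ i ]≔ v

  near-self : ∀ e → Near e e
  near-self e = 0F , proj₁ e , refl

  disjoint-not-near-both : ∀ {q q′ g} → Disjoint q q′ → Near q g → Near q′ g → ⊥
  disjoint-not-near-both {_ , _ , _} {_ , _ , _} (_ , d₁ , _) (0F , _ , refl) (0F , _ , refl) = d₁ refl
  disjoint-not-near-both {_ , _ , _} {_ , _ , _} (_ , _ , d₂) (0F , _ , refl) (1F , _ , refl) = d₂ refl
  disjoint-not-near-both {_ , _ , _} {_ , _ , _} (_ , d₁ , _) (0F , _ , refl) (2F , _ , refl) = d₁ refl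
  disjoint-not-near-both {_ , _ , _} {_ , _ , _} (_ , _ , d₂) (1F , _ , refl) (0F , _ , refl) = d₂ refl
  disjoint-not-near-both {_ , _ , _} {_ , _ , _} (d₀ , _ , _) (1F , _ , refl) (1F , _ , refl) = d₀ refl
  disjoint-not-near-both {_ , _ , _} {_ , _ , _} (d₀ , _ , _) (1F , _ , refl) (2F , _ , refl) = d₀ refl
  disjoint-not-near-both {_ , _ , _} {_ , _ , _} (_ , d₁ , _) (2F , _ , refl) (0F , _ , refl) = d₁ refl
  disjoint-not-near-both {_ , _ , _} {_ , _ , _} (d₀ , _ , _) (2F , _ , refl) (1F , _ , refl) = d₀ refl
  disjoint-not-near-both {_ , _ , _} {_ , _ , _} (d₀ , _ , _) (2F , _ , refl) (2F , _ , refl) = d₀ refl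

module ℒ-upper {n : ℕ} (3≤n : 3 ≤ n) where

  disjoint-from-both : ∀ e e′ → Σ[ k ∈ KEdge n ] Disjoint k e × Disjoint k e′
  disjoint-from-both (a , b , c) (a′ , b′ , c′)
    with fresh-index 3≤n a a′ | fresh-index 3≤n b b′ | fresh-index 3≤n c c′
  ... | k₀ , k₀≢a , k₀≢a′ | k₁ , k₁≢b , k₁≢b′ | k₂ , k₂≢c , k₂≢c′ =
    (k₀ , k₁ , k₂) , (k₀≢a , k₁≢b , k₂≢c) , (k₀≢a′ , k₁≢b′ , k₂≢c′)

  -- (a₀ , b₁ , g₂) meets each of a, b, g in one vertex and differs in colour from a or from b.
  disjoint-triple : ∀ (col : Colouring n) {a b g} → Disjoint a b → Disjoint a g → Disjoint b g →
                    Distinct₃ (col a) (col b) (col g) → RainbowCopy col ℒ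
  disjoint-triple col {a₀ , a₁ , a₂} {b₀ , b₁ , b₂} {g₀ , g₁ , g₂}
                  (a₀≢b₀ , a₁≢b₁ , a₂≢b₂) (a₀≢g₀ , a₁≢g₁ , a₂≢g₂) (b₀≢g₀ , b₁≢g₁ , b₂≢g₂) (A≢B , A≢C , B≢C)
    with col (a₀ , b₁ , g₂) ℕ.≟ col (a₀ , a₁ , a₂) | col (a₀ , b₁ , g₂) ℕ.≟ col (b₀ , b₁ , b₂)
  ... | yes H≡A | _ = rainbow-unpermute col rotʳ (rainbow-ℒ (col ∘ permute rotʳ)
          b₁≢g₁ b₂≢g₂ (a₀≢b₀ ∘ sym , b₀≢g₀ , a₀≢g₀)
          ((λ eq → A≢B (trans (sym H≡A) (sym eq))) , B≢C , (λ eq → A≢C (trans (sym H≡A) eq))))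
  ... | no H≢A | yes H≡B = rainbow-unpermute col swap₁₂ (rainbow-ℒ (col ∘ permute swap₁₂)
          a₀≢g₀ a₂≢g₂ (a₁≢b₁ , a₁≢g₁ , b₁≢g₁)
          (H≢A ∘ sym , A≢C , (λ eq → B≢C (trans (sym H≡B) eq))))
  ... | no H≢A | no H≢B = rainbow-ℒ col a₀≢b₀ a₁≢b₁ (a₂≢g₂ , a₂≢b₂ , b₂≢g₂ ∘ sym) (H≢A ∘ sym , A≢B , H≢B)

  -- The loose paths run through (x₁ , t , z′) with x₁ fresh or, if that edge has the colour of c,
  -- through (x′ , t , z).
  fan : ∀ (col : Colouring n) {x y z t w b} → t ≢ y → w ≢ z → Disjoint b (x , y , z) → Disjoint b (x , t , w) →
        Distinct₃ (col (x , y , z)) (col b) (col (x , t , w)) → RainbowCopy col ℒ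
  fan col {x} {y} {z} {t} {w} {x′ , y′ , z′} t≢y w≢z (x′≢x , y′≢y , z′≢z) (_ , y′≢t , z′≢w) (A≢B , A≢C , B≢C)
    with fresh-index 3≤n x x′
  ... | x₁ , x₁≢x , x₁≢x′ with col (x₁ , t , z′) ℕ.≟ col (x , t , w)
  ... | no H≢C with col (x₁ , t , z′) ℕ.≟ col (x , y , z)
  ... | no H≢A = rainbow-ℒ col (x₁≢x ∘ sym) (t≢y ∘ sym) (w≢z ∘ sym , z′≢z ∘ sym , z′≢w ∘ sym)
                   (A≢C , H≢A ∘ sym , H≢C ∘ sym)
  ... | yes H≡A = rainbow-unpermute col rotʳ (rainbow-ℒ (col ∘ permute rotʳ)
                   (y′≢t ∘ sym) (z′≢w ∘ sym) (x₁≢x ∘ sym , x′≢x ∘ sym , x₁≢x′)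
                   (H≢C ∘ sym , B≢C ∘ sym , (λ eq → A≢B (trans (sym H≡A) eq))))
  fan col {x} {y} {z} {t} {w} {x′ , y′ , z′} t≢y w≢z (x′≢x , y′≢y , z′≢z) (_ , y′≢t , z′≢w) (A≢B , A≢C , B≢C)
    | x₁ , x₁≢x , x₁≢x′ | yes H≡C
    with col (x′ , t , z) ℕ.≟ col (x , y , z) | col (x′ , t , z) ℕ.≟ col (x′ , y′ , z′)
  ... | yes K≡A | _ = rainbow-ℒ col x′≢x y′≢t (z′≢z , z′≢w , w≢z ∘ sym)
          ((λ eq → A≢B (trans (sym K≡A) (sym eq))) , B≢C , (λ eq → A≢C (trans (sym K≡A) eq)))
  ... | no K≢A | yes K≡B = rainbow-unpermute col rotʳ (rainbow-ℒ (col ∘ permute rotʳ)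
          t≢y z′≢z (x₁≢x′ , x₁≢x , x′≢x)
          ((λ eq → B≢C (trans (sym K≡B) (trans (sym eq) H≡C))) , (λ eq → A≢C (trans (sym eq) H≡C)) , K≢A))
  ... | no K≢A | no K≢B = rainbow-unpermute col rotˡ (rainbow-ℒ (col ∘ permute rotˡ)
          (z′≢z ∘ sym) (x′≢x ∘ sym) (t≢y ∘ sym , y′≢y ∘ sym , y′≢t ∘ sym)
          (K≢A ∘ sym , A≢B , K≢B))

  fan₁ : ∀ (col : Colouring n) {x y z t w b} → t ≢ y → w ≢ z → Disjoint b (y , x , z) → Disjoint b (t , x , w) →
         Distinct₃ (col (y , x , z)) (col b) (col (t , x , w)) → RainbowCopy col ℒ
  fan₁ col {b = b₀ , b₁ , b₂} t≢y w≢z (b₀≢y , b₁≢x , b₂≢z) (b₀≢t , _ , b₂≢w) distinct =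
    rainbow-unpermute col swap₀₁ (fan (col ∘ permute swap₀₁) {b = b₁ , b₀ , b₂} t≢y w≢z
      (b₁≢x , b₀≢y , b₂≢z) (b₁≢x , b₀≢t , b₂≢w) distinct)

  fan₂ : ∀ (col : Colouring n) {x y z t w b} → t ≢ y → w ≢ z → Disjoint b (y , z , x) → Disjoint b (t , w , x) →
         Distinct₃ (col (y , z , x)) (col b) (col (t , w , x)) → RainbowCopy col ℒ
  fan₂ col {b = b₀ , b₁ , b₂} t≢y w≢z (b₀≢y , b₁≢z , b₂≢x) (b₀≢t , b₁≢w , _) distinct =
    rainbow-unpermute col swap₀₂ (fan (col ∘ permute swap₀₂) {b = b₂ , b₁ , b₀} w≢z t≢y
      (b₂≢x , b₁≢z , b₀≢y) (b₂≢x , b₁≢w , b₀≢t) distinct)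

  near-or-rainbow : ∀ (col : Colouring n) {a b g} → Disjoint a b → col a ≢ col b →
                    col g ≢ col a → col g ≢ col b → RainbowCopy col ℒ ⊎ (Near a g ⊎ Near b g)
  near-or-rainbow col {a₀ , a₁ , a₂} {b₀ , b₁ , b₂} {g₀ , g₁ , g₂} a∦b@(d₀ , d₁ , d₂) A≢B C≢A C≢B
    with g₀ ≟ a₀ | g₁ ≟ a₁ | g₂ ≟ a₂ | g₀ ≟ b₀ | g₁ ≟ b₁ | g₂ ≟ b₂
  ... | _        | yes refl | yes refl | _        | _        | _        = inj₂ (inj₁ (0F , g₀ , refl))
  ... | yes refl | _        | yes refl | _        | _        | _        = inj₂ (inj₁ (1F , g₁ , refl))
  ... | yes refl | yes refl | _        | _        | _        | _        = inj₂ (inj₁ (2F , g₂ , refl))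
  ... | _        | _        | _        | _        | yes refl | yes refl = inj₂ (inj₂ (0F , g₀ , refl))
  ... | _        | _        | _        | yes refl | _        | yes refl = inj₂ (inj₂ (1F , g₁ , refl))
  ... | _        | _        | _        | yes refl | yes refl | _        = inj₂ (inj₂ (2F , g₂ , refl))
  ... | yes refl | _        | _        | yes refl | _        | _        = ⊥-elim (d₀ refl)
  ... | _        | yes refl | _        | _        | yes refl | _        = ⊥-elim (d₁ refl)
  ... | _        | _        | yes refl | _        | _        | yes refl = ⊥-elim (d₂ refl)
  ... | no n₀    | no n₁    | no n₂    | no m₀    | no m₁    | no m₂    = inj₁ (disjoint-triple col a∦b
          (n₀ ∘ sym , n₁ ∘ sym , n₂ ∘ sym) (m₀ ∘ sym , m₁ ∘ sym , m₂ ∘ sym) (A≢B , C≢A ∘ sym , C≢B ∘ sym))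
  ... | yes refl | no n₁    | no n₂    | no m₀    | no m₁    | no m₂    = inj₁ (fan col n₁ n₂
          (Disjoint-sym a∦b) (d₀ ∘ sym , m₁ ∘ sym , m₂ ∘ sym) (A≢B , C≢A ∘ sym , C≢B ∘ sym))
  ... | no n₀    | yes refl | no n₂    | no m₀    | no m₁    | no m₂    = inj₁ (fan₁ col n₀ n₂
          (Disjoint-sym a∦b) (m₀ ∘ sym , d₁ ∘ sym , m₂ ∘ sym) (A≢B , C≢A ∘ sym , C≢B ∘ sym))
  ... | no n₀    | no n₁    | yes refl | no m₀    | no m₁    | no m₂    = inj₁ (fan₂ col n₀ n₁
          (Disjoint-sym a∦b) (m₀ ∘ sym , m₁ ∘ sym , d₂ ∘ sym) (A≢B , C≢A ∘ sym , C≢B ∘ sym))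
  ... | no n₀    | no n₁    | no n₂    | yes refl | no m₁    | no m₂    = inj₁ (fan col m₁ m₂
          a∦b (d₀ , n₁ ∘ sym , n₂ ∘ sym) (A≢B ∘ sym , C≢B ∘ sym , C≢A ∘ sym))
  ... | no n₀    | no n₁    | no n₂    | no m₀    | yes refl | no m₂    = inj₁ (fan₁ col m₀ m₂
          a∦b (n₀ ∘ sym , d₁ , n₂ ∘ sym) (A≢B ∘ sym , C≢B ∘ sym , C≢A ∘ sym))
  ... | no n₀    | no n₁    | no n₂    | no m₀    | no m₁    | yes refl = inj₁ (fan₂ col m₀ m₁
          a∦b (n₀ ∘ sym , n₁ ∘ sym , d₂) (A≢B ∘ sym , C≢B ∘ sym , C≢A ∘ sym))
  ... | yes refl | no n₁    | no n₂    | no m₀    | yes refl | no m₂    = inj₁ (rainbow-ℒ col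
          d₀ d₁ (n₂ ∘ sym , d₂ , m₂) (C≢A ∘ sym , A≢B , C≢B))
  ... | yes refl | no n₁    | no n₂    | no m₀    | no m₁    | yes refl = inj₁ (rainbow-unpermute col swap₁₂
          (rainbow-ℒ (col ∘ permute swap₁₂) d₀ d₂ (n₁ ∘ sym , d₁ , m₁) (C≢A ∘ sym , A≢B , C≢B)))
  ... | no n₀    | yes refl | no n₂    | yes refl | no m₁    | no m₂    = inj₁ (rainbow-unpermute col swap₀₁
          (rainbow-ℒ (col ∘ permute swap₀₁) d₁ d₀ (n₂ ∘ sym , d₂ , m₂) (C≢A ∘ sym , A≢B , C≢B)))
  ... | no n₀    | yes refl | no n₂    | no m₀    | no m₁    | yes refl = inj₁ (rainbow-unpermute col rotʳ
          (rainbow-ℒ (col ∘ permute rotʳ) d₁ d₂ (n₀ ∘ sym , d₀ , m₀) (C≢A ∘ sym , A≢B , C≢B)))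
  ... | no n₀    | no n₁    | yes refl | yes refl | no m₁    | no m₂    = inj₁ (rainbow-unpermute col rotˡ
          (rainbow-ℒ (col ∘ permute rotˡ) d₂ d₀ (n₁ ∘ sym , d₁ , m₁) (C≢A ∘ sym , A≢B , C≢B)))
  ... | no n₀    | no n₁    | yes refl | no m₀    | yes refl | no m₂    = inj₁ (rainbow-unpermute col swap₀₂
          (rainbow-ℒ (col ∘ permute swap₀₂) d₂ d₁ (n₀ ∘ sym , d₀ , m₀) (C≢A ∘ sym , A≢B , C≢B)))

  disjoint-from-lines : ∀ {p k : KEdge n} {i j u v} → i ≢ j →
    Disjoint k (p [ i ]≔ u) → Disjoint k (p [ j ]≔ v) → Disjoint k p
  disjoint-from-lines {_ , _ , _} {_ , _ , _} {0F} {0F} i≢j _ _ = ⊥-elim (i≢j refl)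
  disjoint-from-lines {_ , _ , _} {_ , _ , _} {1F} {1F} i≢j _ _ = ⊥-elim (i≢j refl)
  disjoint-from-lines {_ , _ , _} {_ , _ , _} {2F} {2F} i≢j _ _ = ⊥-elim (i≢j refl)
  disjoint-from-lines {_ , _ , _} {_ , _ , _} {0F} {1F} _ (_ , d₁ , d₂) (d₀ , _ , _) = d₀ , d₁ , d₂
  disjoint-from-lines {_ , _ , _} {_ , _ , _} {0F} {2F} _ (_ , d₁ , d₂) (d₀ , _ , _) = d₀ , d₁ , d₂
  disjoint-from-lines {_ , _ , _} {_ , _ , _} {1F} {0F} _ (d₀ , _ , d₂) (_ , d₁ , _) = d₀ , d₁ , d₂
  disjoint-from-lines {_ , _ , _} {_ , _ , _} {1F} {2F} _ (d₀ , _ , d₂) (_ , d₁ , _) = d₀ , d₁ , d₂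
  disjoint-from-lines {_ , _ , _} {_ , _ , _} {2F} {0F} _ (d₀ , d₁ , _) (_ , _ , d₂) = d₀ , d₁ , d₂
  disjoint-from-lines {_ , _ , _} {_ , _ , _} {2F} {1F} _ (d₀ , d₁ , _) (_ , _ , d₂) = d₀ , d₁ , d₂

  fan-on-lines : ∀ (col : Colouring n) {p k : KEdge n} {i j u v} → i ≢ j → u ≢ coord p i → v ≢ coord p j →
    Disjoint k (p [ i ]≔ u) → Disjoint k (p [ j ]≔ v) →
    Distinct₃ (col (p [ i ]≔ u)) (col k) (col (p [ j ]≔ v)) → RainbowCopy col ℒ
  fan-on-lines col {_ , _ , _} {i = 0F} {0F} i≢j _ _ _ _ _ = ⊥-elim (i≢j refl)
  fan-on-lines col {_ , _ , _} {i = 1F} {1F} i≢j _ _ _ _ _ = ⊥-elim (i≢j refl)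
  fan-on-lines col {_ , _ , _} {i = 2F} {2F} i≢j _ _ _ _ _ = ⊥-elim (i≢j refl)
  fan-on-lines col {_ , _ , _} {i = 1F} {2F} _ u≢ v≢ = fan col (u≢ ∘ sym) v≢
  fan-on-lines col {_ , _ , _} {i = 2F} {1F} _ u≢ v≢ = fan col v≢ (u≢ ∘ sym)
  fan-on-lines col {_ , _ , _} {i = 0F} {2F} _ u≢ v≢ = fan₁ col (u≢ ∘ sym) v≢
  fan-on-lines col {_ , _ , _} {i = 2F} {0F} _ u≢ v≢ = fan₁ col v≢ (u≢ ∘ sym)
  fan-on-lines col {_ , _ , _} {i = 0F} {1F} _ u≢ v≢ = fan₂ col (u≢ ∘ sym) v≢
  fan-on-lines col {_ , _ , _} {i = 1F} {0F} _ u≢ v≢ = fan₂ col v≢ (u≢ ∘ sym)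

  two-lines : ∀ (col : Colouring n) {p : KEdge n} {P X} →
    (∀ k → Disjoint k p → RainbowCopy col ℒ ⊎ OneOf P X (col k)) →
    ∀ {i j u v} → i ≢ j → u ≢ coord p i → v ≢ coord p j → col (p [ i ]≔ u) ≢ col (p [ j ]≔ v) →
    ¬ OneOf P X (col (p [ i ]≔ u)) → ¬ OneOf P X (col (p [ j ]≔ v)) → RainbowCopy col ℒ
  two-lines col {p} off-p {i} {j} {u} {v} i≢j u≢ v≢ g₁≢g₂ outside₁ outside₂
    with disjoint-from-both (p [ i ]≔ u) (p [ j ]≔ v)
  ... | k , k∦g₁ , k∦g₂ with off-p k (disjoint-from-lines i≢j k∦g₁ k∦g₂)
  ... | inj₁ rainbow  = rainbow
  ... | inj₂ k-inside = fan-on-lines col i≢j u≢ v≢ k∦g₁ k∦g₂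
          (¬OneOf⇒≢ outside₁ k-inside , g₁≢g₂ , ¬OneOf⇒≢ outside₂ k-inside ∘ sym)

  -- Every edge of a colour other than col p and col q lies on a line through p, and two such
  -- edges of different colours on different lines yield ℒ; so all of them lie on one line.
  module Repeated-colour (col : Colouring n) (uses : UsesAtLeast col (n + 2)) {p q q′ : KEdge n}
                         (p∦q : Disjoint p q) (p∦q′ : Disjoint p q′) (q∦q′ : Disjoint q q′)
                         (P≢X : col p ≢ col q) (q′≡q : col q′ ≡ col q) where

    near-p : ∀ g → ¬ OneOf (col p) (col q) (col g) → RainbowCopy col ℒ ⊎ Near p g
    near-p g outside with near-or-rainbow col p∦q P≢X (outside ∘ inj₁) (outside ∘ inj₂)
    ... | inj₁ copy             = inj₁ copy
    ... | inj₂ (inj₁ near-p)    = inj₂ near-p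
    ... | inj₂ (inj₂ near-q)    =
      map₂ (λ { (inj₁ near-p) → near-p ; (inj₂ near-q′) → ⊥-elim (disjoint-not-near-both q∦q′ near-q near-q′) })
           (near-or-rainbow col p∦q′ (λ eq → P≢X (trans eq q′≡q)) (outside ∘ inj₁)
                            (λ eq → outside (inj₂ (trans eq q′≡q))))

    off-p : ∀ k → Disjoint k p → RainbowCopy col ℒ ⊎ OneOf (col p) (col q) (col k)
    off-p k k∦p with one-of? (col p) (col q) (col k)
    ... | yes inside = inj₂ inside
    ... | no outside = map₂ (λ near → ⊥-elim (disjoint-not-near-both (Disjoint-sym k∦p) near (near-self k)))
                            (near-p k outside)

    off-centre : ∀ {i v} → ¬ OneOf (col p) (col q) (col (p [ i ]≔ v)) → v ≢ coord p i
    off-centre {i} outside refl = outside (inj₁ (cong col (update-coord p i)))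

    line-colours : Fin 3 → Fin (ℕ.suc n) → ℕ
    line-colours i 0F      = col q
    line-colours i (suc v) = col (p [ i ]≔ v)

    on-line : ∀ {i v} → ¬ OneOf (col p) (col q) (col (p [ i ]≔ v)) →
              ∀ e → RainbowCopy col ℒ ⊎ Σ[ l ∈ Fin (ℕ.suc n) ] col e ≡ line-colours i l
    on-line {i} {v} s-outside e with one-of? (col p) (col q) (col e)
    ... | yes (inj₁ e≡P) = inj₂ (suc (coord p i) , trans e≡P (cong col (sym (update-coord p i))))
    ... | yes (inj₂ e≡X) = inj₂ (0F , e≡X)
    ... | no e-outside with near-p e e-outside
    ... | inj₁ copy = inj₁ copy
    ... | inj₂ (j , u , refl) with j ≟ i
    ... | yes refl = inj₂ (suc u , refl)
    ... | no j≢i with col (p [ j ]≔ u) ℕ.≟ col (p [ i ]≔ v)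
    ... | yes same  = inj₂ (suc v , same)
    ... | no differ = inj₁ (two-lines col off-p j≢i (off-centre e-outside) (off-centre s-outside)
                                      differ e-outside s-outside)

    rainbow : RainbowCopy col ℒ
    rainbow with fresh-colour₂ col (ℕₚ.≤-trans 3≤n (ℕₚ.m≤m+n n 2)) uses (col p) (col q)
    ... | s , s-outside with near-p s s-outside
    ... | inj₁ copy         = copy
    ... | inj₂ (i , v , refl) =
      few-colours col (ℕₚ.≤-reflexive (ℕₚ.+-comm 2 n)) uses (line-colours i) (on-line s-outside)

  disjoint-pair : ∀ (col : Colouring n) → UsesAtLeast col (n + 2) → ∀ {a b} → Disjoint a b → col a ≢ col b →
                  RainbowCopy col ℒ
  disjoint-pair col uses {a} {b} a∦b A≢B with disjoint-from-both a b
  ... | k , k∦a , k∦b with one-of? (col a) (col b) (col k)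
  ... | no outside     = disjoint-triple col a∦b (Disjoint-sym k∦a) (Disjoint-sym k∦b)
                           (A≢B , ¬OneOf⇒≢ outside (inj₁ refl) ∘ sym , ¬OneOf⇒≢ outside (inj₂ refl) ∘ sym)
  ... | yes (inj₁ k≡A) = Repeated-colour.rainbow col uses
                           (Disjoint-sym a∦b) (Disjoint-sym k∦b) (Disjoint-sym k∦a)
                           (A≢B ∘ sym) k≡A
  ... | yes (inj₂ k≡B) = Repeated-colour.rainbow col uses a∦b (Disjoint-sym k∦a) (Disjoint-sym k∦b) A≢B k≡B

  ℒ-forced : Forces n ℒ (n + 2)
  ℒ-forced col uses with two-colours col (uses-mono col (ℕₚ.m≤n+m 2 n) uses)
  ... | e , e′ , e≢e′ with disjoint-from-both e e′
  ... | k , k∦e , k∦e′ with col k ℕ.≟ col e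
  ... | no k≢e  = disjoint-pair col uses (Disjoint-sym k∦e) (k≢e ∘ sym)
  ... | yes k≡e = disjoint-pair col uses (Disjoint-sym k∦e′) (λ eq → e≢e′ (trans (sym k≡e) (sym eq)))

theorem1p19 : ∀ (n : ℕ) → 3 ≤ n →
    AR≡ n ℳ (n + 1) × AR≡ n 𝒯 (n + 2) × AR≡ n ℒ (n + 2)
theorem1p19 n 3≤n =
  (ℳ-upper.ℳ-forced 3≤n , ℳ-lower) ,
  (𝒯-upper.𝒯-forced 3≤n , 𝒯-lower (ℕₚ.<⇒≤ 3≤n)) ,
  (ℒ-upper.ℒ-forced 3≤n , ℒ-lower (ℕₚ.<⇒≤ 3≤n))
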